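{- Let $F$ be the field of odd prime order $p\equiv 1\pmod 4$. Let $S^*$ be the set of nonzero squares of $F$ and $N^*=(F\setminus\{0\})\setminus S^*$ the set of non-squares. Let $A=S^*\cap(N^*+1)$ and $B=S^*\cap(N^*-1)$, where $N^*\pm1=\{n\pm1: n\in N^*\}$. Then $|(A\setminus B)\cup(B\setminus A)|\ge 2$, that is, $|A\cup B|\ge |A|+2$. -}

module Defs where

open import Data.Nat using (ℕ; suc; _+_; _*_; _%_; NonZero)
open import Data.Nat.Properties using (_≟_)
open import Data.Fin using (Fin; toℕ)
open import Data.Fin.Properties using (any?)
open import Data.Fin.Subset using (Subset)
open import Data.Vec using (tabulate)
open import Data.Product using (∃; _×_; _,_)
open import Relation.Nullary using (¬_; Dec; does)
open import Relation.Nullary.Decidable using (_×-dec_; ¬?)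
open import Relation.Binary.PropositionalEquality using (_≡_)

-- The prime field F_p is modelled as Fin p, with arithmetic modulo p on
-- the representatives 0,…,p-1 (via toℕ).

module Field (p : ℕ) .{{_ : NonZero p}} where

  IsNonzeroSquare : Fin p → Set
  IsNonzeroSquare x = ¬ (toℕ x ≡ 0) × ∃ λ (y : Fin p) → (toℕ y * toℕ y) % p ≡ toℕ x

  isNonzeroSquare? : (x : Fin p) → Dec (IsNonzeroSquare x)
  isNonzeroSquare? x = ¬? (toℕ x ≟ 0) ×-dec any? (λ y → (toℕ y * toℕ y) % p ≟ toℕ x)

  IsNonSquare : Fin p → Set
  IsNonSquare x = ¬ (toℕ x ≡ 0) × ¬ IsNonzeroSquare x

  isNonSquare? : (x : Fin p) → Dec (IsNonSquare x)
  isNonSquare? x = ¬? (toℕ x ≟ 0) ×-dec ¬? (isNonzeroSquare? x)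

  InA : Fin p → Set
  InA x = IsNonzeroSquare x × ∃ λ (n : Fin p) → IsNonSquare n × (toℕ n + 1) % p ≡ toℕ x

  inA? : (x : Fin p) → Dec (InA x)
  inA? x = isNonzeroSquare? x ×-dec any? (λ n → isNonSquare? n ×-dec ((toℕ n + 1) % p ≟ toℕ x))

  -- B = S* ∩ (N* − 1):  x is a nonzero square and x = n − 1 for some non-square n,
  -- i.e. x + 1 = n  (in F_p).
  InB : Fin p → Set
  InB x = IsNonzeroSquare x × ∃ λ (n : Fin p) → IsNonSquare n × (toℕ x + 1) % p ≡ toℕ n

  inB? : (x : Fin p) → Dec (InB x)
  inB? x = isNonzeroSquare? x ×-dec any? (λ n → isNonSquare? n ×-dec ((toℕ x + 1) % p ≟ toℕ n))

  A : Subset p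
  A = tabulate (λ x → does (inA? x))

  B : Subset p
  B = tabulate (λ x → does (inB? x))

module Submission where

-- Since p ≡ 1 (mod 4), h = (p - 1)/2 is even. Sending each x ∈ [2, h] to the representative
-- in [1, h] of ±x⁻¹ is an involution of a set of odd size h - 1, so it has a fixed point x,
-- and as x² ≢ 1 we get x² ≡ -1. Hence negation preserves squares and non-squares. A
-- non-square exists, for otherwise x ↦ ±√x would inject [1, h + 1] into [1, h]. If m + 2 is
-- the least non-square (1 is a square), then m + 1 is a square followed by a non-square but
-- not preceded by one, so m + 1 ∈ B ∖ A; negating, -(m + 1) ∈ A ∖ B, and m + 1 ≢ -(m + 1)
-- as p is odd.

open import Defs
open import Data.Nat using (ℕ; zero; suc; _+_; _*_; _∸_; _≤_; _<_; _%_; _/_; NonZero; z≤n; s≤s; z<s; _≟_; _≤?_; nonTrivial⇒≢1)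
open import Data.Nat.Properties
open import Data.Nat.DivMod using (m%n<n; m%n≤n; m%n%n≡m%n; m*n%n≡0; m<n⇒m%n≡m; m≡m%n+[m/n]*n; %-distribˡ-+; %-distribˡ-*)
open import Data.Nat.Divisibility using (_∣_; n∣m⇒m%n≡0)
open import Data.Nat.GCD using (module Bézout; module GCD; GCD)
open import Data.Nat.Primality using (Prime; prime⇒nonZero; prime⇒irreducible; prime⇒nonTrivial)
open import Data.Nat.Tactic.RingSolver using (solve-∀)
open import Data.Empty using (⊥-elim)
open import Data.Fin using (Fin; Fin′; toℕ; fromℕ<; inject)
open import Data.Fin.Properties using (any?; toℕ-fromℕ<; toℕ<n; toℕ-inject; pigeonhole; ¬∀⟶∃¬-smallest)
open import Data.Fin.Subset using (Subset; _∈_; _∉_; ∣_∣; _─_; _∪_)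
open import Data.Fin.Subset.Properties using (x∈p∪q⁺; x∈p∧x∉q⇒x∈p─q; x∈p∧x≢y⇒x∈p-y; x∈p⇒∣p-x∣<∣p∣)
open import Data.Vec using (tabulate)
open import Data.Vec.Properties using (lookup∘tabulate; lookup⇒[]=; []=⇒lookup)
open import Data.Product using (∃; _×_; _,_; proj₁; proj₂)
open import Data.Product.Function.NonDependent.Propositional using (_×-⇔_)
open import Data.Sum using (_⊎_; inj₁; inj₂)
open import Function using (_∘_; _⇔_; mk⇔; Equivalence)
open import Function.Construct.Composition using (_⇔-∘_)
open import Function.Related.TypeIsomorphisms using (¬-cong-⇔)
open import Relation.Nullary using (¬_; Dec; yes; no; does; contradiction)
open import Relation.Nullary.Decidable using (map′; decidable-stable; ¬?; dec-true)
import Relation.Nullary.Decidable as Dec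
open import Relation.Binary.Bundles using (Setoid)
open import Relation.Binary.Structures using (IsEquivalence)
open import Relation.Binary.PropositionalEquality

-- Fixed-point-free involutions

transpose : ℕ → ℕ → ℕ → ℕ
transpose a b x with x ≟ a
... | yes _ = b
... | no _ with x ≟ b
...   | yes _ = a
...   | no _ = x

transpose-left : ∀ a b → transpose a b a ≡ b
transpose-left a b with a ≟ a
... | yes _ = refl
... | no a≢a = contradiction refl a≢a

transpose-right : ∀ a b → transpose a b b ≡ a
transpose-right a b with b ≟ a
... | yes b≡a = b≡a
... | no _ with b ≟ b
...   | yes _ = refl
...   | no b≢b = contradiction refl b≢b

transpose-other : ∀ {a b x} → x ≢ a → x ≢ b → transpose a b x ≡ x
transpose-other {a} {b} {x} x≢a x≢b with x ≟ a
... | yes x≡a = contradiction x≡a x≢a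
... | no _ with x ≟ b
...   | yes x≡b = contradiction x≡b x≢b
...   | no _ = refl

transpose-involutive : ∀ a b x → transpose a b (transpose a b x) ≡ x
transpose-involutive a b x with x ≟ a
... | yes refl = transpose-right x b
... | no x≢a with x ≟ b
...   | yes refl = transpose-left a x
...   | no x≢b = transpose-other x≢a x≢b

transpose-< : ∀ {n a b} x → a < n → b < n → x < n → transpose a b x < n
transpose-< {a = a} {b} x a<n b<n x<n with x ≟ a
... | yes _ = b<n
... | no _ with x ≟ b
...   | yes _ = a<n
...   | no _ = x<n

2+-even : ∀ {n} → (∃ λ m → n ≡ 2 * m) → ∃ λ m → 2 + n ≡ 2 * m
2+-even (m , refl) = suc m , sym (*-distribˡ-+ 2 1 m)

<2+n⇒<n : ∀ {n x} → x < 2 + n → x ≢ n → x ≢ suc n → x < n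
<2+n⇒<n x<2+n x≢n x≢1+n with m<1+n⇒m<n∨m≡n x<2+n
... | inj₂ x≡1+n = contradiction x≡1+n x≢1+n
... | inj₁ x<1+n with m<1+n⇒m<n∨m≡n x<1+n
...   | inj₁ x<n = x<n
...   | inj₂ x≡n = contradiction x≡n x≢n

fixedPointFree-involution⇒even : ∀ n (f : ℕ → ℕ) →
  (∀ {x} → x < n → f x < n) → (∀ {x} → x < n → f (f x) ≡ x) → (∀ {x} → x < n → f x ≢ x) →
  ∃ λ m → n ≡ 2 * m
fixedPointFree-involution⇒even zero f _ _ _ = 0 , refl
fixedPointFree-involution⇒even (suc zero) f closed _ fixedPointFree =
  contradiction (n<1⇒n≡0 (closed z<s)) (fixedPointFree z<s)
fixedPointFree-involution⇒even (suc (suc n)) f closed involutive fixedPointFree =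
  2+-even (fixedPointFree-involution⇒even n g g-closed (g-involutive ∘ weaken) g-fixedPointFree)
  where
  open ≡-Reasoning
  -- Conjugating by the transposition of f (n + 1) and n turns f into an involution g
  -- exchanging n and n + 1, which therefore restricts to [0, n).
  N : ℕ
  N = suc n
  τ : ℕ → ℕ
  τ = transpose (f N) n
  g : ℕ → ℕ
  g x = τ (f (τ x))

  weaken : ∀ {x} → x < n → x < suc N
  weaken x<n = m<n⇒m<1+n (m<n⇒m<1+n x<n)

  τ-closed : ∀ {x} → x < suc N → τ x < suc N
  τ-closed = transpose-< _ (closed ≤-refl) (m<n⇒m<1+n ≤-refl)

  g-involutive : ∀ {x} → x < suc N → g (g x) ≡ x
  g-involutive {x} x<2+n = begin
    τ (f (τ (τ (f (τ x))))) ≡⟨ cong (τ ∘ f) (transpose-involutive (f N) n (f (τ x))) ⟩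
    τ (f (f (τ x)))         ≡⟨ cong τ (involutive (τ-closed x<2+n)) ⟩
    τ (τ x)                 ≡⟨ transpose-involutive (f N) n x ⟩
    x                       ∎

  g-top : g N ≡ n
  g-top = begin
    τ (f (τ N)) ≡⟨ cong (τ ∘ f) (transpose-other (fixedPointFree ≤-refl ∘ sym) 1+n≢n) ⟩
    τ (f N)     ≡⟨ transpose-left (f N) n ⟩
    n           ∎

  g-bottom : g n ≡ N
  g-bottom = trans (cong g (sym g-top)) (g-involutive {N} ≤-refl)

  g-closed : ∀ {x} → x < n → g x < n
  g-closed {x} x<n = <2+n⇒<n (τ-closed (closed (τ-closed (weaken x<n)))) gx≢n gx≢N
    where
    x≡g : ∀ {y} → g x ≡ y → x ≡ g y
    x≡g gx≡y = trans (sym (g-involutive (weaken x<n))) (cong g gx≡y)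
    gx≢n : g x ≢ n
    gx≢n gx≡n = <-irrefl (trans (x≡g gx≡n) g-bottom) (m<n⇒m<1+n x<n)
    gx≢N : g x ≢ N
    gx≢N gx≡N = <-irrefl (trans (x≡g gx≡N) g-top) x<n

  g-fixedPointFree : ∀ {x} → x < n → g x ≢ x
  g-fixedPointFree {x} x<n gx≡x = fixedPointFree (τ-closed (weaken x<n)) (begin
    f (τ x)         ≡⟨ transpose-involutive (f N) n (f (τ x)) ⟨
    τ (g x)         ≡⟨ cong τ gx≡x ⟩
    τ x             ∎)

∈-tabulate⇔ : ∀ {n} {Q : Fin n → Set} (Q? : ∀ x → Dec (Q x)) {x} → x ∈ tabulate (λ y → does (Q? y)) ⇔ Q x
∈-tabulate⇔ {Q = Q} Q? {x} = mk⇔ to from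
  where
  to : x ∈ tabulate (λ y → does (Q? y)) → Q x
  to x∈ with Q? x | trans (sym (lookup∘tabulate (λ y → does (Q? y)) x)) ([]=⇒lookup x∈)
  ... | yes q | _  = q
  ... | no _  | ()
  from : Q x → x ∈ tabulate (λ y → does (Q? y))
  from q = lookup⇒[]= x _ (trans (lookup∘tabulate (λ y → does (Q? y)) x) (dec-true (Q? x) q))

x∈p∧x∉q⇒x∈p∆q : ∀ {n} {p q : Subset n} {x} → x ∈ p → x ∉ q → x ∈ (p ─ q) ∪ (q ─ p)
x∈p∧x∉q⇒x∈p∆q x∈p x∉q = x∈p∪q⁺ (inj₁ (x∈p∧x∉q⇒x∈p─q x∈p x∉q))

x∈q∧x∉p⇒x∈p∆q : ∀ {n} {p q : Subset n} {x} → x ∈ q → x ∉ p → x ∈ (p ─ q) ∪ (q ─ p)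
x∈q∧x∉p⇒x∈p∆q x∈q x∉p = x∈p∪q⁺ (inj₂ (x∈p∧x∉q⇒x∈p─q x∈q x∉p))

two-elements⇒2≤∣p∣ : ∀ {n} {p : Subset n} {x y} → x ≢ y → x ∈ p → y ∈ p → 2 ≤ ∣ p ∣
two-elements⇒2≤∣p∣ x≢y x∈p y∈p =
  ≤-<-trans (≤-<-trans z≤n (x∈p⇒∣p-x∣<∣p∣ (x∈p∧x≢y⇒x∈p-y y∈p (x≢y ∘ sym)))) (x∈p⇒∣p-x∣<∣p∣ x∈p)

-- Arithmetic modulo P

module Modular (P : ℕ) .{{_ : NonZero P}} where

  infix 4 _≈_
  -- A record rather than a synonym for a % P ≡ b % P, so that a and b are inferable.
  record _≈_ (a b : ℕ) : Set where
    constructor mod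
    field %-≡ : a % P ≡ b % P
  open _≈_ public

  ≈-isEquivalence : IsEquivalence _≈_
  ≈-isEquivalence = record
    { refl  = mod refl
    ; sym   = λ (mod e) → mod (sym e)
    ; trans = λ (mod e) (mod f) → mod (trans e f)
    }

  ≈-setoid : Setoid _ _
  ≈-setoid = record { isEquivalence = ≈-isEquivalence }

  open IsEquivalence ≈-isEquivalence public
    using () renaming (refl to ≈-refl; sym to ≈-sym; trans to ≈-trans)

  ≡⇒≈ : ∀ {a b} → a ≡ b → a ≈ b
  ≡⇒≈ refl = ≈-refl

  infix 4 _≈?_
  _≈?_ : ∀ a b → Dec (a ≈ b)
  a ≈? b = map′ mod %-≡ (a % P ≟ b % P)

  +-cong : ∀ {a b c d} → a ≈ b → c ≈ d → a + c ≈ b + d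
  +-cong {a} {b} {c} {d} (mod e) (mod f) = mod (begin
    (a + c) % P             ≡⟨ %-distribˡ-+ a c P ⟩
    (a % P + c % P) % P     ≡⟨ cong₂ (λ u v → (u + v) % P) e f ⟩
    (b % P + d % P) % P     ≡⟨ %-distribˡ-+ b d P ⟨
    (b + d) % P             ∎)
    where open ≡-Reasoning

  *-cong : ∀ {a b c d} → a ≈ b → c ≈ d → a * c ≈ b * d
  *-cong {a} {b} {c} {d} (mod e) (mod f) = mod (begin
    (a * c) % P             ≡⟨ %-distribˡ-* a c P ⟩
    (a % P * (c % P)) % P   ≡⟨ cong₂ (λ u v → (u * v) % P) e f ⟩
    (b % P * (d % P)) % P   ≡⟨ %-distribˡ-* b d P ⟨
    (b * d) % P             ∎)
    where open ≡-Reasoning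

  +-congˡ : ∀ a {b c} → b ≈ c → a + b ≈ a + c
  +-congˡ a = +-cong (≈-refl {a})

  +-congʳ : ∀ a {b c} → b ≈ c → b + a ≈ c + a
  +-congʳ a b≈c = +-cong b≈c (≈-refl {a})

  *-congˡ : ∀ a {b c} → b ≈ c → a * b ≈ a * c
  *-congˡ a = *-cong (≈-refl {a})

  *-congʳ : ∀ a {b c} → b ≈ c → b * a ≈ c * a
  *-congʳ a b≈c = *-cong b≈c (≈-refl {a})

  m%P≈m : ∀ a → a % P ≈ a
  m%P≈m a = mod (m%n%n≡m%n a P)

  m*P≈0 : ∀ a → a * P ≈ 0
  m*P≈0 a = mod (trans (m*n%n≡0 a P) (sym (m*n%n≡0 0 P)))

  ∣⇒≈0 : ∀ {a} → P ∣ a → a ≈ 0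
  ∣⇒≈0 {a} P∣a = mod (trans (n∣m⇒m%n≡0 a P P∣a) (sym (m*n%n≡0 0 P)))

  ≈⇒≡ : ∀ {a b} → a < P → b < P → a ≈ b → a ≡ b
  ≈⇒≡ a<P b<P (mod e) = trans (sym (m<n⇒m%n≡m a<P)) (trans e (m<n⇒m%n≡m b<P))

  infix 8 -_
  -_ : ℕ → ℕ
  - a = P ∸ a % P

  +-inverseʳ : ∀ a → a + - a ≈ 0
  +-inverseʳ a = begin
    a + - a       ≈⟨ +-congʳ (- a) (m%P≈m a) ⟨
    a % P + - a   ≡⟨ m+[n∸m]≡n (m%n≤n a P) ⟩
    P             ≡⟨ *-identityˡ P ⟨
    1 * P         ≈⟨ m*P≈0 1 ⟩
    0             ∎
    where open import Relation.Binary.Reasoning.Setoid ≈-setoid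

  +-inverseˡ : ∀ a → - a + a ≈ 0
  +-inverseˡ a = ≈-trans (≡⇒≈ (+-comm (- a) a)) (+-inverseʳ a)

  +-cancelʳ : ∀ {a b} c → a + c ≈ b + c → a ≈ b
  +-cancelʳ {a} {b} c a+c≈b+c = begin
    a               ≡⟨ +-identityʳ a ⟨
    a + 0           ≈⟨ +-congˡ _ (+-inverseʳ c) ⟨
    a + (c + - c)   ≡⟨ +-assoc a c (- c) ⟨
    a + c + - c     ≈⟨ +-congʳ (- c) a+c≈b+c ⟩
    b + c + - c     ≡⟨ +-assoc b c (- c) ⟩
    b + (c + - c)   ≈⟨ +-congˡ _ (+-inverseʳ c) ⟩
    b + 0           ≡⟨ +-identityʳ b ⟩
    b               ∎
    where open import Relation.Binary.Reasoning.Setoid ≈-setoid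

  +-inverse-unique : ∀ {a b c} → a + c ≈ 0 → b + c ≈ 0 → a ≈ b
  +-inverse-unique a+c≈0 b+c≈0 = +-cancelʳ _ (≈-trans a+c≈0 (≈-sym b+c≈0))

-- The prime field of order P = 2h + 1

[2+n]n+1≡[1+n][1+n] : ∀ n → (2 + n) * n + 1 ≡ suc n * suc n
[2+n]n+1≡[1+n][1+n] = solve-∀

module OddPrime (h : ℕ) (prime : Prime (suc (2 * h))) where

  P : ℕ
  P = suc (2 * h)

  open Modular P public
  open Field P
  open import Relation.Binary.Reasoning.Setoid ≈-setoid

  1≤h : 1 ≤ h
  1≤h = n≢0⇒n>0 (nonTrivial⇒≢1 {{prime⇒nonTrivial prime}} ∘ cong (suc ∘ (2 *_)))

  h≤2h : h ≤ 2 * h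
  h≤2h = m≤m+n h (h + 0)

  0<a≤2h⇒a≉0 : ∀ {a} → 0 < a → a ≤ 2 * h → ¬ a ≈ 0
  0<a≤2h⇒a≉0 0<a a≤2h a≈0 = <-irrefl (sym (≈⇒≡ (s≤s a≤2h) z<s a≈0)) 0<a

  a≉0⇒0<a : ∀ {a} → ¬ a ≈ 0 → 0 < a
  a≉0⇒0<a {zero}  0≉0 = contradiction ≈-refl 0≉0
  a≉0⇒0<a {suc _} _   = z<s

  0≉1 : ¬ 0 ≈ 1
  0≉1 0≈1 = 0<a≤2h⇒a≉0 z<s (≤-trans 1≤h h≤2h) (≈-sym 0≈1)

  gcd≡1 : ∀ {a d} → GCD a P d → ¬ a ≈ 0 → d ≡ 1
  gcd≡1 g a≉0 with prime⇒irreducible prime (GCD.gcd∣n g)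
  ... | inj₁ d≡1 = d≡1
  ... | inj₂ refl = contradiction (∣⇒≈0 (GCD.gcd∣m g)) a≉0

  recip : ℕ → ℕ
  recip a with Bézout.lemma a P
  ... | Bézout.result _ _ (Bézout.+- x _ _) = x
  ... | Bézout.result _ _ (Bézout.-+ x _ _) = - x

  *-recip : ∀ {a} → ¬ a ≈ 0 → a * recip a ≈ 1
  *-recip {a} a≉0 with Bézout.lemma a P
  ... | Bézout.result d g (Bézout.+- x y eq) with refl ← gcd≡1 g a≉0 = begin
    a * x      ≡⟨ *-comm a x ⟩
    x * a      ≡⟨ eq ⟨
    1 + y * P  ≈⟨ +-congˡ 1 (m*P≈0 y) ⟩
    1          ∎
  ... | Bézout.result d g (Bézout.-+ x y eq) with refl ← gcd≡1 g a≉0 =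
    +-inverse-unique a*-x+a*x≈0 1+a*x≈0
    where
    a*-x+a*x≈0 : a * - x + a * x ≈ 0
    a*-x+a*x≈0 = begin
      a * - x + a * x  ≡⟨ *-distribˡ-+ a (- x) x ⟨
      a * (- x + x)    ≈⟨ *-congˡ a (+-inverseˡ x) ⟩
      a * 0            ≡⟨ *-zeroʳ a ⟩
      0                ∎
    1+a*x≈0 : 1 + a * x ≈ 0
    1+a*x≈0 = begin
      1 + a * x  ≡⟨ cong (1 +_) (*-comm a x) ⟩
      1 + x * a  ≡⟨ eq ⟩
      y * P      ≈⟨ m*P≈0 y ⟩
      0          ∎

  *-cancelˡ : ∀ {a b c} → ¬ a ≈ 0 → a * b ≈ a * c → b ≈ c
  *-cancelˡ {a} {b} {c} a≉0 ab≈ac = begin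
    b                  ≡⟨ *-identityˡ b ⟨
    1 * b              ≈⟨ *-congʳ b (*-recip a≉0) ⟨
    a * recip a * b    ≡⟨ reassociate b ⟩
    recip a * (a * b)  ≈⟨ *-congˡ (recip a) ab≈ac ⟩
    recip a * (a * c)  ≡⟨ reassociate c ⟨
    a * recip a * c    ≈⟨ *-congʳ c (*-recip a≉0) ⟩
    1 * c              ≡⟨ *-identityˡ c ⟩
    c                  ∎
    where
    reassociate : ∀ x → a * recip a * x ≡ recip a * (a * x)
    reassociate x = trans (cong (_* x) (*-comm a (recip a))) (*-assoc (recip a) a x)

  opposite-square : ∀ {a b} → a + b ≈ 0 → a * a ≈ b * b
  opposite-square {a} {b} a+b≈0 =
    +-inverse-unique (annihilated a (sym (*-distribˡ-+ a a b)))
                     (annihilated b (trans (+-comm (b * b) (a * b))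
                                    (trans (cong (_+ b * b) (*-comm a b)) (sym (*-distribˡ-+ b a b)))))
    where
    annihilated : ∀ c {d} → d ≡ c * (a + b) → d ≈ 0
    annihilated c refl = ≈-trans (*-congˡ c a+b≈0) (≡⇒≈ (*-zeroʳ c))

  ≤h⇒<P : ∀ {a} → a ≤ h → a < P
  ≤h⇒<P a≤h = s≤s (≤-trans a≤h h≤2h)

  0<a≤h⇒a≉0 : ∀ {a} → 0 < a → a ≤ h → ¬ a ≈ 0
  0<a≤h⇒a≉0 0<a a≤h = 0<a≤2h⇒a≉0 0<a (≤-trans a≤h h≤2h)

  a≤h⇒b≤h⇒a+b≤2h : ∀ {a b} → a ≤ h → b ≤ h → a + b ≤ 2 * h
  a≤h⇒b≤h⇒a+b≤2h a≤h b≤h = ≤-trans (+-mono-≤ a≤h b≤h) (≤-reflexive (cong (h +_) (sym (+-identityʳ h))))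

  abs : ℕ → ℕ
  abs a with a % P ≤? h
  ... | yes _ = a % P
  ... | no _  = - a

  abs≤h : ∀ a → abs a ≤ h
  abs≤h a with a % P ≤? h
  ... | yes a%P≤h = a%P≤h
  ... | no a%P≰h  = ≤-trans (∸-monoʳ-≤ P (≰⇒> a%P≰h))
                            (≤-reflexive (trans (m+n∸m≡n h (h + 0)) (+-identityʳ h)))

  abs≈± : ∀ a → abs a ≈ a ⊎ abs a + a ≈ 0
  abs≈± a with a % P ≤? h
  ... | yes _ = inj₁ (m%P≈m a)
  ... | no _  = inj₂ (+-inverseˡ a)

  abs≉0 : ∀ {a} → ¬ a ≈ 0 → ¬ abs a ≈ 0
  abs≉0 {a} a≉0 abs≈0 with abs≈± a
  ... | inj₁ abs≈a   = a≉0 (≈-trans (≈-sym abs≈a) abs≈0)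
  ... | inj₂ abs+a≈0 = a≉0 (≈-trans (+-congʳ a (≈-sym abs≈0)) abs+a≈0)

  abs-square : ∀ a → abs a * abs a ≈ a * a
  abs-square a with abs≈± a
  ... | inj₁ abs≈a   = *-cong abs≈a abs≈a
  ... | inj₂ abs+a≈0 = opposite-square {abs a} abs+a≈0

  SignedInverse : ℕ → ℕ → Set
  SignedInverse x y = x * y ≈ 1 ⊎ x * y + 1 ≈ 0

  signedInverse-sym : ∀ {x y} → SignedInverse x y → SignedInverse y x
  signedInverse-sym {x} {y} (inj₁ xy≈1)   = inj₁ (≈-trans (≡⇒≈ (*-comm y x)) xy≈1)
  signedInverse-sym {x} {y} (inj₂ xy+1≈0) = inj₂ (≈-trans (≡⇒≈ (cong (_+ 1) (*-comm y x))) xy+1≈0)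

  ¬opposite-signs : ∀ {x y z} → ¬ x ≈ 0 → 0 < y → y ≤ h → z ≤ h → x * y ≈ 1 → ¬ x * z + 1 ≈ 0
  ¬opposite-signs {x} {y} {z} x≉0 0<y y≤h z≤h xy≈1 xz+1≈0 =
    0<a≤2h⇒a≉0 (<-≤-trans 0<y (m≤n+m y z)) (a≤h⇒b≤h⇒a+b≤2h z≤h y≤h) (*-cancelˡ x≉0 x[z+y]≈x*0)
    where
    x[z+y]≈x*0 : x * (z + y) ≈ x * 0
    x[z+y]≈x*0 = begin
      x * (z + y)    ≡⟨ *-distribˡ-+ x z y ⟩
      x * z + x * y  ≈⟨ +-congˡ (x * z) xy≈1 ⟩
      x * z + 1      ≈⟨ xz+1≈0 ⟩
      0              ≡⟨ *-zeroʳ x ⟨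
      x * 0          ∎

  signedInverse-unique : ∀ {x y z} → ¬ x ≈ 0 → 0 < y → y ≤ h → 0 < z → z ≤ h →
                         SignedInverse x y → SignedInverse x z → y ≡ z
  signedInverse-unique x≉0 _ y≤h _ z≤h (inj₁ xy≈1) (inj₁ xz≈1) =
    ≈⇒≡ (≤h⇒<P y≤h) (≤h⇒<P z≤h) (*-cancelˡ x≉0 (≈-trans xy≈1 (≈-sym xz≈1)))
  signedInverse-unique x≉0 _ y≤h _ z≤h (inj₂ xy+1≈0) (inj₂ xz+1≈0) =
    ≈⇒≡ (≤h⇒<P y≤h) (≤h⇒<P z≤h) (*-cancelˡ x≉0 (+-cancelʳ 1 (≈-trans xy+1≈0 (≈-sym xz+1≈0))))
  signedInverse-unique x≉0 0<y y≤h _ z≤h (inj₁ xy≈1) (inj₂ xz+1≈0) =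
    contradiction xz+1≈0 (¬opposite-signs x≉0 0<y y≤h z≤h xy≈1)
  signedInverse-unique x≉0 _ y≤h 0<z z≤h (inj₂ xy+1≈0) (inj₁ xz≈1) =
    contradiction xy+1≈0 (¬opposite-signs x≉0 0<z z≤h y≤h xz≈1)

  recip≉0 : ∀ {x} → ¬ x ≈ 0 → ¬ recip x ≈ 0
  recip≉0 {x} x≉0 r≈0 = 0≉1 (begin
    0            ≡⟨ *-zeroʳ x ⟨
    x * 0        ≈⟨ *-congˡ x r≈0 ⟨
    x * recip x  ≈⟨ *-recip x≉0 ⟩
    1            ∎)

  partner : ℕ → ℕ
  partner x = abs (recip x)

  partner≤h : ∀ x → partner x ≤ h
  partner≤h x = abs≤h (recip x)

  0<partner : ∀ {x} → ¬ x ≈ 0 → 0 < partner x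
  0<partner x≉0 = a≉0⇒0<a (abs≉0 (recip≉0 x≉0))

  partner-signedInverse : ∀ {x} → ¬ x ≈ 0 → SignedInverse x (partner x)
  partner-signedInverse {x} x≉0 with abs≈± (recip x)
  ... | inj₁ abs≈r   = inj₁ (≈-trans (*-congˡ x abs≈r) (*-recip x≉0))
  ... | inj₂ abs+r≈0 = inj₂ (begin
    x * abs r + 1            ≈⟨ +-congˡ (x * abs r) (*-recip x≉0) ⟨
    x * abs r + x * r        ≡⟨ *-distribˡ-+ x (abs r) r ⟨
    x * (abs r + r)          ≈⟨ *-congˡ x abs+r≈0 ⟩
    x * 0                    ≡⟨ *-zeroʳ x ⟩
    0                        ∎)
    where
    r : ℕ
    r = recip x

  partner-involutive : ∀ {x} → 0 < x → x ≤ h → partner (partner x) ≡ x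
  partner-involutive {x} 0<x x≤h =
    signedInverse-unique y≉0 (0<partner y≉0) (partner≤h y) 0<x x≤h
      (partner-signedInverse y≉0) (signedInverse-sym {x} (partner-signedInverse x≉0))
    where
    x≉0 : ¬ x ≈ 0
    x≉0 = 0<a≤h⇒a≉0 0<x x≤h
    y : ℕ
    y = partner x
    y≉0 : ¬ y ≈ 0
    y≉0 = 0<a≤h⇒a≉0 (0<partner x≉0) (partner≤h x)

  partner-1 : partner 1 ≡ 1
  partner-1 = signedInverse-unique 1≉0 (0<partner 1≉0) (partner≤h 1) z<s 1≤h
                (partner-signedInverse 1≉0) (inj₁ ≈-refl)
    where
    1≉0 : ¬ 1 ≈ 0
    1≉0 = 0<a≤h⇒a≉0 z<s 1≤h

  1<partner : ∀ {x} → 1 < x → x ≤ h → 1 < partner x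
  1<partner {x} 1<x x≤h = ≤∧≢⇒< (0<partner (0<a≤h⇒a≉0 0<x x≤h)) 1≢partner
    where
    0<x : 0 < x
    0<x = <-trans z<s 1<x
    1≢partner : 1 ≢ partner x
    1≢partner 1≡px = <-irrefl 1≡x 1<x
      where
      1≡x : 1 ≡ x
      1≡x = trans (sym partner-1) (trans (cong partner 1≡px) (partner-involutive 0<x x≤h))

  ¬square≈1 : ∀ {x} → 1 < x → x ≤ h → ¬ x * x ≈ 1
  ¬square≈1 {suc d} (s≤s 0<d) 1+d≤h x²≈1 =
    0<a≤h⇒a≉0 0<d (≤-trans (n≤1+n d) 1+d≤h) (*-cancelˡ [2+d]≉0 [2+d]d≈[2+d]0)
    where
    [2+d]≉0 : ¬ 2 + d ≈ 0
    [2+d]≉0 = 0<a≤2h⇒a≉0 z<s (≤-trans (s≤s 1+d≤h) (a≤h⇒b≤h⇒a+b≤2h 1≤h ≤-refl))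
    [2+d]d≈[2+d]0 : (2 + d) * d ≈ (2 + d) * 0
    [2+d]d≈[2+d]0 = +-cancelʳ 1 (begin
      (2 + d) * d + 1   ≡⟨ [2+n]n+1≡[1+n][1+n] d ⟩
      suc d * suc d     ≈⟨ x²≈1 ⟩
      1                 ≡⟨ cong (_+ 1) (*-zeroʳ (2 + d)) ⟨
      (2 + d) * 0 + 1   ∎)

  partner-fixed⇒root : ∀ {x} → 1 < x → x ≤ h → partner x ≡ x → x * x + 1 ≈ 0
  partner-fixed⇒root {x} 1<x x≤h px≡x
    with subst (SignedInverse x) px≡x (partner-signedInverse (0<a≤h⇒a≉0 (<-trans z<s 1<x) x≤h))
  ... | inj₁ x²≈1   = contradiction x²≈1 (¬square≈1 1<x x≤h)
  ... | inj₂ x²+1≈0 = x²+1≈0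

  -- When h is even, [2, h] has odd size, so the involution partner of it has a fixed point,
  -- which is a square root of -1.
  sqrt-1 : ∀ {j} → h ≡ 2 * j → ∃ λ i → i * i + 1 ≈ 0
  sqrt-1 {j} h≡2j with any? (λ (i : Fin P) → toℕ i * toℕ i + 1 ≈? 0)
  ... | yes (i , i²+1≈0) = toℕ i , i²+1≈0
  ... | no ∄root = ⊥-elim (h-odd (fixedPointFree-involution⇒even (h ∸ 1) f f-closed f-involutive f-fixedPointFree))
    where
    1+[h∸1]≡h : 1 + (h ∸ 1) ≡ h
    1+[h∸1]≡h = m+[n∸m]≡n 1≤h

    h-odd : ¬ ∃ λ m → h ∸ 1 ≡ 2 * m
    h-odd (m , h∸1≡2m) = even≢odd j m (trans (sym h≡2j) (trans (sym 1+[h∸1]≡h) (cong suc h∸1≡2m)))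

    f : ℕ → ℕ
    f i = partner (2 + i) ∸ 2

    2+i≤h : ∀ {i} → i < h ∸ 1 → 2 + i ≤ h
    2+i≤h i<h∸1 = subst (_ ≤_) 1+[h∸1]≡h (s≤s i<h∸1)

    2+f : ∀ {i} → i < h ∸ 1 → 2 + f i ≡ partner (2 + i)
    2+f i<h∸1 = m+[n∸m]≡n (1<partner (s≤s (s≤s z≤n)) (2+i≤h i<h∸1))

    f-closed : ∀ {i} → i < h ∸ 1 → f i < h ∸ 1
    f-closed {i} i<h∸1 = ≤-pred (subst₂ _≤_ (sym (2+f i<h∸1)) (sym 1+[h∸1]≡h) (partner≤h (2 + i)))

    f-involutive : ∀ {i} → i < h ∸ 1 → f (f i) ≡ i
    f-involutive {i} i<h∸1 = cong (_∸ 2) (trans (cong partner (2+f i<h∸1)) (partner-involutive {2 + i} z<s (2+i≤h i<h∸1)))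

    f-fixedPointFree : ∀ {i} → i < h ∸ 1 → f i ≢ i
    f-fixedPointFree {i} i<h∸1 fi≡i = ∄root (fromℕ< 2+i<P , subst (λ y → y * y + 1 ≈ 0) (sym (toℕ-fromℕ< 2+i<P))
      (partner-fixed⇒root (s≤s (s≤s z≤n)) (2+i≤h i<h∸1) (trans (sym (2+f i<h∸1)) (cong (2 +_) fi≡i))))
      where
      2+i<P : 2 + i < P
      2+i<P = ≤h⇒<P (2+i≤h i<h∸1)

  -- Squares and non-squares

  NonzeroSquare : ℕ → Set
  NonzeroSquare a = ¬ a ≈ 0 × ∃ λ y → y * y ≈ a

  NonSquare : ℕ → Set
  NonSquare a = ¬ a ≈ 0 × ¬ NonzeroSquare a

  ≉0-resp : ∀ {a b} → a ≈ b → ¬ a ≈ 0 → ¬ b ≈ 0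
  ≉0-resp a≈b a≉0 b≈0 = a≉0 (≈-trans a≈b b≈0)

  nonzeroSquare-resp : ∀ {a b} → a ≈ b → NonzeroSquare a → NonzeroSquare b
  nonzeroSquare-resp a≈b (a≉0 , y , y²≈a) = ≉0-resp a≈b a≉0 , y , ≈-trans y²≈a a≈b

  nonSquare-resp : ∀ {a b} → a ≈ b → NonSquare a → NonSquare b
  nonSquare-resp a≈b (a≉0 , a∉□) = ≉0-resp a≈b a≉0 , a∉□ ∘ nonzeroSquare-resp (≈-sym a≈b)

  nonzeroSquare-1 : NonzeroSquare 1
  nonzeroSquare-1 = 0<a≤h⇒a≉0 z<s 1≤h , 1 , ≈-refl

  nonzeroSquare⇒root≤h : ∀ {a} → NonzeroSquare a → ∃ λ y → 0 < y × y ≤ h × y * y ≈ a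
  nonzeroSquare⇒root≤h (a≉0 , y , y²≈a) =
    abs y , a≉0⇒0<a (abs≉0 y≉0) , abs≤h y , ≈-trans (abs-square y) y²≈a
    where
    y≉0 : ¬ y ≈ 0
    y≉0 y≈0 = a≉0 (≈-trans (≈-sym y²≈a) (*-cong y≈0 y≈0))

  ¬all-nonzeroSquare : ¬ (∀ {a} → ¬ a ≈ 0 → NonzeroSquare a)
  ¬all-nonzeroSquare all□ =
    let (i , j , i<j , rootᵢ≡rootⱼ) = pigeonhole (n<1+n h) pred∘root in
    <-irrefl (pred∘root-injective rootᵢ≡rootⱼ) i<j
    where
    1+i≤2h : (i : Fin (suc h)) → suc (toℕ i) ≤ 2 * h
    1+i≤2h i = ≤-trans (toℕ<n i) (a≤h⇒b≤h⇒a+b≤2h 1≤h ≤-refl)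

    rootSpec : (i : Fin (suc h)) → ∃ λ y → 0 < y × y ≤ h × y * y ≈ suc (toℕ i)
    rootSpec i = nonzeroSquare⇒root≤h (all□ (0<a≤2h⇒a≉0 z<s (1+i≤2h i)))

    root : Fin (suc h) → ℕ
    root i = proj₁ (rootSpec i)

    1+[root∸1]≡root : ∀ i → 1 + (root i ∸ 1) ≡ root i
    1+[root∸1]≡root i = m+[n∸m]≡n (proj₁ (proj₂ (rootSpec i)))

    pred∘root : Fin (suc h) → Fin h
    pred∘root i = fromℕ< (subst (_≤ h) (sym (1+[root∸1]≡root i)) (proj₁ (proj₂ (proj₂ (rootSpec i)))))

    root-injective : ∀ {i j} → root i ≈ root j → toℕ i ≡ toℕ j
    root-injective {i} {j} rootᵢ≈rootⱼ = suc-injective (≈⇒≡ (s≤s (1+i≤2h i)) (s≤s (1+i≤2h j)) (begin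
      suc (toℕ i)        ≈⟨ proj₂ (proj₂ (proj₂ (rootSpec i))) ⟨
      root i * root i    ≈⟨ *-cong rootᵢ≈rootⱼ rootᵢ≈rootⱼ ⟩
      root j * root j    ≈⟨ proj₂ (proj₂ (proj₂ (rootSpec j))) ⟩
      suc (toℕ j)        ∎))

    pred∘root-injective : ∀ {i j} → pred∘root i ≡ pred∘root j → toℕ i ≡ toℕ j
    pred∘root-injective {i} {j} eq = root-injective (begin
      root i               ≡⟨ 1+[root∸1]≡root i ⟨
      suc (root i ∸ 1)     ≡⟨ cong suc (toℕ-fromℕ< _) ⟨
      suc (toℕ (pred∘root i)) ≡⟨ cong (suc ∘ toℕ) eq ⟩
      suc (toℕ (pred∘root j)) ≡⟨ cong suc (toℕ-fromℕ< _) ⟩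
      suc (root j ∸ 1)     ≡⟨ 1+[root∸1]≡root j ⟩
      root j               ∎)

  SquareAfterNonSquare : ℕ → Set
  SquareAfterNonSquare a = NonzeroSquare a × ∃ λ n → NonSquare n × n + 1 ≈ a

  SquareBeforeNonSquare : ℕ → Set
  SquareBeforeNonSquare a = NonzeroSquare a × ∃ λ n → NonSquare n × a + 1 ≈ n

  residue : ℕ → Fin P
  residue a = fromℕ< (m%n<n a P)

  toℕ-residue : ∀ a → toℕ (residue a) ≈ a
  toℕ-residue a = ≈-trans (≡⇒≈ (toℕ-fromℕ< _)) (m%P≈m a)

  toℕ%P≡toℕ : (x : Fin P) → toℕ x % P ≡ toℕ x
  toℕ%P≡toℕ x = m<n⇒m%n≡m (toℕ<n x)

  ≈toℕ⇒%≡toℕ : ∀ {a} (x : Fin P) → a ≈ toℕ x → a % P ≡ toℕ x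
  ≈toℕ⇒%≡toℕ x (mod a%≡x%) = trans a%≡x% (toℕ%P≡toℕ x)

  %≡toℕ⇒≈toℕ : ∀ {a} (x : Fin P) → a % P ≡ toℕ x → a ≈ toℕ x
  %≡toℕ⇒≈toℕ x a%≡x = mod (trans a%≡x (sym (toℕ%P≡toℕ x)))

  residue-injective : ∀ {a b} → residue a ≡ residue b → a ≈ b
  residue-injective {a} {b} eq = ≈-trans (≈-sym (toℕ-residue a)) (≈-trans (≡⇒≈ (cong toℕ eq)) (toℕ-residue b))

  toℕ≢0⇔≉0 : ∀ {x a} → toℕ x ≈ a → (¬ toℕ x ≡ 0) ⇔ (¬ a ≈ 0)
  toℕ≢0⇔≉0 {x} x≈a = mk⇔
    (λ x≢0 a≈0 → x≢0 (≈⇒≡ (toℕ<n x) z<s (≈-trans x≈a a≈0)))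
    (λ a≉0 x≡0 → a≉0 (≈-trans (≈-sym x≈a) (≡⇒≈ x≡0)))

  hasRoot⇔ : ∀ {x a} → toℕ x ≈ a → (∃ λ (y : Fin P) → (toℕ y * toℕ y) % P ≡ toℕ x) ⇔ (∃ λ y → y * y ≈ a)
  hasRoot⇔ {x} x≈a = mk⇔
    (λ (y , y²%≡x) → toℕ y , ≈-trans (%≡toℕ⇒≈toℕ x y²%≡x) x≈a)
    (λ (y , y²≈a) → residue y , ≈toℕ⇒%≡toℕ x
      (≈-trans (*-cong (toℕ-residue y) (toℕ-residue y)) (≈-trans y²≈a (≈-sym x≈a))))

  isNonzeroSquare⇔ : ∀ {x a} → toℕ x ≈ a → IsNonzeroSquare x ⇔ NonzeroSquare a
  isNonzeroSquare⇔ x≈a = toℕ≢0⇔≉0 x≈a ×-⇔ hasRoot⇔ x≈a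

  isNonSquare⇔ : ∀ {x a} → toℕ x ≈ a → IsNonSquare x ⇔ NonSquare a
  isNonSquare⇔ x≈a = toℕ≢0⇔≉0 x≈a ×-⇔ ¬-cong-⇔ (isNonzeroSquare⇔ x≈a)

  inA⇔ : ∀ {x a} → toℕ x ≈ a → InA x ⇔ SquareAfterNonSquare a
  inA⇔ {x} x≈a = isNonzeroSquare⇔ x≈a ×-⇔ mk⇔
    (λ (n , n∉□ , n+1%≡x) → toℕ n , to (isNonSquare⇔ ≈-refl) n∉□ , ≈-trans (%≡toℕ⇒≈toℕ x n+1%≡x) x≈a)
    (λ (n , n∉□ , n+1≈a) → residue n , from (isNonSquare⇔ (toℕ-residue n)) n∉□ , ≈toℕ⇒%≡toℕ x
      (≈-trans (+-congʳ 1 (toℕ-residue n)) (≈-trans n+1≈a (≈-sym x≈a))))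
    where open Equivalence

  inB⇔ : ∀ {x a} → toℕ x ≈ a → InB x ⇔ SquareBeforeNonSquare a
  inB⇔ {x} x≈a = isNonzeroSquare⇔ x≈a ×-⇔ mk⇔
    (λ (n , n∉□ , x+1%≡n) → toℕ n , to (isNonSquare⇔ ≈-refl) n∉□ ,
      ≈-trans (+-congʳ 1 (≈-sym x≈a)) (%≡toℕ⇒≈toℕ n x+1%≡n))
    (λ (n , n∉□ , a+1≈n) → residue n , from (isNonSquare⇔ (toℕ-residue n)) n∉□ , ≈toℕ⇒%≡toℕ (residue n)
      (≈-trans (+-congʳ 1 x≈a) (≈-trans a+1≈n (≈-sym (toℕ-residue n)))))
    where open Equivalence

  residue∈A⇔ : ∀ a → residue a ∈ A ⇔ SquareAfterNonSquare a
  residue∈A⇔ a = inA⇔ (toℕ-residue a) ⇔-∘ ∈-tabulate⇔ inA?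

  residue∈B⇔ : ∀ a → residue a ∈ B ⇔ SquareBeforeNonSquare a
  residue∈B⇔ a = inB⇔ (toℕ-residue a) ⇔-∘ ∈-tabulate⇔ inB?

  nonzeroSquare? : ∀ a → Dec (NonzeroSquare a)
  nonzeroSquare? a = Dec.map (isNonzeroSquare⇔ (toℕ-residue a)) (isNonzeroSquare? (residue a))

  ¬nonSquare⇒nonzeroSquare : ∀ {a} → ¬ a ≈ 0 → ¬ NonSquare a → NonzeroSquare a
  ¬nonSquare⇒nonzeroSquare a≉0 ¬a∉□ = decidable-stable (nonzeroSquare? _) (λ ¬a∈□ → ¬a∉□ (a≉0 , ¬a∈□))

  ¬all-¬isNonSquare : ¬ (∀ x → ¬ IsNonSquare x)
  ¬all-¬isNonSquare none = ¬all-nonzeroSquare λ {a} a≉0 → ¬nonSquare⇒nonzeroSquare a≉0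
    (none (residue a) ∘ Equivalence.from (isNonSquare⇔ (toℕ-residue a)))

  leastNonSquare : ∃ λ w → w < P × NonSquare w × ∀ {a} → a < w → ¬ NonSquare a
  leastNonSquare = fromFin (¬∀⟶∃¬-smallest P (¬_ ∘ IsNonSquare) (¬? ∘ isNonSquare?) ¬all-¬isNonSquare)
    where
    fromFin : (∃ λ w → ¬ ¬ IsNonSquare w × ((v : Fin′ w) → ¬ IsNonSquare (inject v))) →
              ∃ λ w → w < P × NonSquare w × ∀ {a} → a < w → ¬ NonSquare a
    fromFin (w , ¬¬w∉□ , below) = toℕ w , toℕ<n w , w∉□ , λ a<w → below (fromℕ< a<w) ∘ toIsNonSquare a<w
      where
      w∉□ : NonSquare (toℕ w)
      w∉□ = Equivalence.to (isNonSquare⇔ {w} ≈-refl) (decidable-stable (isNonSquare? w) ¬¬w∉□)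
      toIsNonSquare : ∀ {a} (a<w : a < toℕ w) → NonSquare a → IsNonSquare (inject (fromℕ< a<w))
      toIsNonSquare {a} a<w = Equivalence.from (isNonSquare⇔ {inject (fromℕ< a<w)} {a}
                          (≡⇒≈ (trans (toℕ-inject (fromℕ< a<w)) (toℕ-fromℕ< a<w))))

  squareFollowedByNonSquare : ∃ λ m → NonzeroSquare (suc m) × NonSquare (2 + m) × ¬ NonSquare m
  squareFollowedByNonSquare = fromLeast leastNonSquare
    where
    fromLeast : (∃ λ w → w < P × NonSquare w × ∀ {a} → a < w → ¬ NonSquare a) →
                ∃ λ m → NonzeroSquare (suc m) × NonSquare (2 + m) × ¬ NonSquare m
    fromLeast (zero , _ , (0≉0 , _) , _)             = contradiction ≈-refl 0≉0
    fromLeast (suc zero , _ , (_ , ¬1∈□) , _)        = contradiction nonzeroSquare-1 ¬1∈□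
    fromLeast (suc (suc m) , 2+m<P , 2+m∉□ , below) =
      m , ¬nonSquare⇒nonzeroSquare 1+m≉0 (below {suc m} (n<1+n (suc m))) , 2+m∉□ ,
      below {m} (m<n⇒m<1+n (n<1+n m))
      where
      1+m≉0 : ¬ suc m ≈ 0
      1+m≉0 = 0<a≤2h⇒a≉0 z<s (≤-pred (<-trans (n<1+n (suc m)) 2+m<P))

  ≉0-opposite : ∀ {a b} → b + a ≈ 0 → ¬ a ≈ 0 → ¬ b ≈ 0
  ≉0-opposite {a} b+a≈0 a≉0 b≈0 = a≉0 (≈-trans (+-congʳ a (≈-sym b≈0)) b+a≈0)

  module SquareRootOfMinusOne (i : ℕ) (i²+1≈0 : i * i + 1 ≈ 0) where

    nonzeroSquare-opposite : ∀ {a b} → b + a ≈ 0 → NonzeroSquare a → NonzeroSquare b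
    nonzeroSquare-opposite {a} {b} b+a≈0 (a≉0 , y , y²≈a) = ≉0-opposite b+a≈0 a≉0 , i * y , (begin
      i * y * (i * y)    ≡⟨ [m*n]*[o*p]≡[m*o]*[n*p] i y i y ⟩
      i * i * (y * y)    ≈⟨ *-congˡ (i * i) y²≈a ⟩
      i * i * a          ≈⟨ +-inverse-unique i²a+a≈0 b+a≈0 ⟩
      b                  ∎)
      where
      i²a+a≈0 : i * i * a + a ≈ 0
      i²a+a≈0 = begin
        i * i * a + a      ≡⟨ cong (i * i * a +_) (*-identityˡ a) ⟨
        i * i * a + 1 * a  ≡⟨ *-distribʳ-+ a (i * i) 1 ⟨
        (i * i + 1) * a    ≈⟨ *-congʳ a i²+1≈0 ⟩
        0                  ∎

    nonSquare-opposite : ∀ {a b} → b + a ≈ 0 → NonSquare a → NonSquare b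
    nonSquare-opposite {a} {b} b+a≈0 (a≉0 , a∉□) =
      ≉0-opposite b+a≈0 a≉0 , a∉□ ∘ nonzeroSquare-opposite (≈-trans (≡⇒≈ (+-comm a b)) b+a≈0)

    module _ {m} (1+m∈□ : NonzeroSquare (suc m)) (2+m∉□ : NonSquare (2 + m)) (¬m∉□ : ¬ NonSquare m) where

      1+m∈B : SquareBeforeNonSquare (suc m)
      1+m∈B = 1+m∈□ , 2 + m , 2+m∉□ , ≡⇒≈ (+-comm (suc m) 1)

      1+m∉A : ¬ SquareAfterNonSquare (suc m)
      1+m∉A (_ , n , n∉□ , n+1≈1+m) = ¬m∉□ (nonSquare-resp n≈m n∉□)
        where
        n≈m : n ≈ m
        n≈m = +-cancelʳ 1 (≈-trans n+1≈1+m (≡⇒≈ (+-comm 1 m)))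

      -[1+m]∈A : SquareAfterNonSquare (- suc m)
      -[1+m]∈A = nonzeroSquare-opposite (+-inverseˡ (suc m)) 1+m∈□ ,
                 - (2 + m) , nonSquare-opposite (+-inverseˡ (2 + m)) 2+m∉□ ,
                 +-inverse-unique (≈-trans (≡⇒≈ (+-assoc (- (2 + m)) 1 (suc m))) (+-inverseˡ (2 + m)))
                                  (+-inverseˡ (suc m))

      -[1+m]∉B : ¬ SquareBeforeNonSquare (- suc m)
      -[1+m]∉B (_ , n , n∉□ , -[1+m]+1≈n) = ¬m∉□ (nonSquare-opposite m+n≈0 n∉□)
        where
        m+n≈0 : m + n ≈ 0
        m+n≈0 = begin
          m + n                 ≈⟨ +-congˡ m -[1+m]+1≈n ⟨
          m + (- suc m + 1)     ≡⟨ +-comm m (- suc m + 1) ⟩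
          - suc m + 1 + m       ≡⟨ +-assoc (- suc m) 1 m ⟩
          - suc m + suc m       ≈⟨ +-inverseˡ (suc m) ⟩
          0                     ∎

      1+m≉-[1+m] : ¬ suc m ≈ - suc m
      1+m≉-[1+m] 1+m≈-[1+m] = proj₁ 1+m∈□ (*-cancelˡ 2≉0 (begin
        2 * suc m             ≡⟨ cong (suc m +_) (+-identityʳ (suc m)) ⟩
        suc m + suc m         ≈⟨ +-congʳ (suc m) 1+m≈-[1+m] ⟩
        - suc m + suc m       ≈⟨ +-inverseˡ (suc m) ⟩
        0                     ≡⟨ *-zeroʳ 2 ⟨
        2 * 0                 ∎))
        where
        2≉0 : ¬ 2 ≈ 0
        2≉0 = 0<a≤2h⇒a≉0 z<s (a≤h⇒b≤h⇒a+b≤2h 1≤h 1≤h)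

      2≤∣A∆B∣ : 2 ≤ ∣ (A ─ B) ∪ (B ─ A) ∣
      2≤∣A∆B∣ = two-elements⇒2≤∣p∣ (1+m≉-[1+m] ∘ residue-injective)
        (x∈q∧x∉p⇒x∈p∆q (from (residue∈B⇔ (suc m)) 1+m∈B) (1+m∉A ∘ to (residue∈A⇔ (suc m))))
        (x∈p∧x∉q⇒x∈p∆q (from (residue∈A⇔ (- suc m)) -[1+m]∈A) (-[1+m]∉B ∘ to (residue∈B⇔ (- suc m))))
        where open Equivalence

p%4≡1⇒p≡1+2[2[p/4]] : ∀ p → p % 4 ≡ 1 → p ≡ suc (2 * (2 * (p / 4)))
p%4≡1⇒p≡1+2[2[p/4]] p p%4≡1 = begin
  p                      ≡⟨ m≡m%n+[m/n]*n p 4 ⟩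
  p % 4 + p / 4 * 4      ≡⟨ cong (_+ p / 4 * 4) p%4≡1 ⟩
  suc (p / 4 * 4)        ≡⟨ cong suc (*-comm (p / 4) 4) ⟩
  suc (4 * (p / 4))      ≡⟨ cong suc (*-assoc 2 2 (p / 4)) ⟩
  suc (2 * (2 * (p / 4))) ∎
  where open ≡-Reasoning

proposition2p7 : (p : ℕ) (pr : Prime p) → p % 4 ≡ 1 →
    2 ≤ ∣ (Field.A p {{prime⇒nonZero pr}} ─ Field.B p {{prime⇒nonZero pr}}) ∪ (Field.B p {{prime⇒nonZero pr}} ─ Field.A p {{prime⇒nonZero pr}}) ∣
proposition2p7 p pr p%4≡1 with p / 4 | p%4≡1⇒p≡1+2[2[p/4]] p p%4≡1
... | j | refl =
  let (_ , 1+m∈□ , 2+m∉□ , ¬m∉□) = squareFollowedByNonSquare in 2≤∣A∆B∣ 1+m∈□ 2+m∉□ ¬m∉□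
  where
  open OddPrime (2 * j) pr
  open SquareRootOfMinusOne (proj₁ (sqrt-1 {j} refl)) (proj₂ (sqrt-1 {j} refl))
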